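{- Let $\mathcal{B}$ be a double blocking set of size $3q-1$ in a projective plane of order $q>4$ such that $\mathcal{B}$ has two $(q-1)$-secants whose intersection point belongs to $\mathcal{B}$. Then $\mathcal{B}$ is a minimal double blocking set.
   Context: A double blocking set is a point set meeting every line in at least two points; it is minimal if no proper subset is a double blocking set. A $t$-secant is a line meeting the set in exactly $t$ points. -}

module Defs where

open import Data.Nat using (ℕ; _+_; _*_; _>_; _≥_)
open import Data.Fin using (Fin)
open import Data.Fin.Subset using (Subset; _∈_; _∉_; _⊂_; _∩_; ∣_∣)
open import Data.Product using (Σ; ∃; ∃-syntax; _×_; _,_)
open import Relation.Binary.PropositionalEquality using (_≡_; _≢_)
open import Relation.Nullary using (¬_)

record ProjectivePlane : Set where
  field
    nP : ℕ
    nL : ℕ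
    pts : Fin nL → Subset nP
    joinLine : ∀ (x y : Fin nP) → x ≢ y →
      Σ (Fin nL) λ ℓ → (x ∈ pts ℓ × y ∈ pts ℓ) ×
        (∀ m → x ∈ pts m → y ∈ pts m → m ≡ ℓ)
    meetPoint : ∀ (ℓ m : Fin nL) → ℓ ≢ m →
      Σ (Fin nP) λ x → (x ∈ pts ℓ × x ∈ pts m) ×
        (∀ y → y ∈ pts ℓ → y ∈ pts m → y ≡ x)
    quadrangle : Σ (Fin nP) λ a → Σ (Fin nP) λ b → Σ (Fin nP) λ c → Σ (Fin nP) λ d →
      (a ≢ b × a ≢ c × a ≢ d × b ≢ c × b ≢ d × c ≢ d) ×
      (∀ ℓ → ¬ (a ∈ pts ℓ × b ∈ pts ℓ × c ∈ pts ℓ)) ×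
      (∀ ℓ → ¬ (a ∈ pts ℓ × b ∈ pts ℓ × d ∈ pts ℓ)) ×
      (∀ ℓ → ¬ (a ∈ pts ℓ × c ∈ pts ℓ × d ∈ pts ℓ)) ×
      (∀ ℓ → ¬ (b ∈ pts ℓ × c ∈ pts ℓ × d ∈ pts ℓ))

open ProjectivePlane public

-- The plane Π has order q: some (equivalently every) line has q+1 points.
-- We use the (standard, equivalent) convention "every line has q + 1 points".
HasOrder : ProjectivePlane → ℕ → Set
HasOrder Π q = ∀ ℓ → ∣ pts Π ℓ ∣ ≡ q + 1

meet : (Π : ProjectivePlane) → Subset (nP Π) → Fin (nL Π) → ℕ
meet Π B ℓ = ∣ B ∩ pts Π ℓ ∣

IsSecant : (Π : ProjectivePlane) → ℕ → Subset (nP Π) → Fin (nL Π) → Set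
IsSecant Π t B ℓ = meet Π B ℓ ≡ t

IsDoubleBlocking : (Π : ProjectivePlane) → Subset (nP Π) → Set
IsDoubleBlocking Π B = ∀ ℓ → meet Π B ℓ ≥ 2

IsMinimalDoubleBlocking : (Π : ProjectivePlane) → Subset (nP Π) → Set
IsMinimalDoubleBlocking Π B =
  IsDoubleBlocking Π B × (∀ C → C ⊂ B → ¬ IsDoubleBlocking Π C)

module Submission where

-- Removing any point x from B destroys the double blocking property; if C ⊆ B
-- were a double blocking set missing x, a count along a pencil of lines gives
-- too many points:
--   * x ∉ ℓb: pick u ∈ ℓb ∖ B.  The q + 1 lines through u partition B; ℓb
--     carries q − 1 points, the line ux carries ≥ 3 (two of C plus x), the other
--     q − 1 lines ≥ 2 each, so |B| ≥ 3q > 3q − 1.  (x ∉ ℓa is symmetric.)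
--   * x = P: the q + 1 lines through P partition B ∖ {P}; ℓa and ℓb carry q − 2
--     points each, the other q − 1 lines ≥ 2 each (they are blocked by C), so
--     3q − 2 ≥ 4q − 6, i.e. q ≤ 4.
-- The file first develops sums of natural numbers over subsets of Fin n and a
-- double counting lemma for incidence families, then the pencil identity
-- |S| = Σ_{m ∋ c} |S ∩ m| (c ∉ S) and the count q + 1 of lines through a point,
-- then the two counting contradictions, and finally the theorem.

open import Defs
open import Data.Nat using (ℕ; _+_; _*_; _∸_; _>_)
open import Data.Fin using (Fin)
open import Data.Fin.Subset using (Subset; _∈_; ∣_∣)
open import Data.Product using (_×_)
open import Relation.Binary.PropositionalEquality using (_≡_; _≢_)

open import Data.Bool using (Bool; true; false; _∧_)
open import Data.Nat using (suc; _≤_; _<_; s≤s)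
open import Data.Nat.Properties
  using ( +-*-semiring; +-commutativeSemigroup; *-commutativeSemigroup
        ; +-assoc; +-comm; +-identityʳ; *-identityʳ; *-zeroʳ; *-suc
        ; +-mono-≤; +-monoʳ-≤; +-cancelʳ-≤; ≤-reflexive; ≤-trans; <⇒≱; m≤m+n; suc-injective
        ; module ≤-Reasoning )
open import Data.Nat.Tactic.RingSolver using (solve-∀)
open import Data.Fin using (zero; suc)
open import Data.Fin.Properties using (any?)
open import Data.Fin.Subset using (_⊆_; _⊂_; _∉_; _∩_; _─_; _-_; ⁅_⁆)
open import Data.Fin.Subset.Properties
  using ( _∈?_; ⊆-antisym; p─⊥≡p; p⊆q⇒∣p∣≤∣q∣; p⊂q⇒∣p∣<∣q∣; x∈p∩q⁺; x∈p∩q⁻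
        ; x∈p∧x≢y⇒x∈p-y; ∣⁅x⁆∣≡1; x∈⁅x⁆; x∈⁅y⁆⇒x≡y )
open import Data.Vec using ([]; _∷_; lookup; tabulate; here; there)
open import Data.Vec.Properties using (lookup∘tabulate; lookup-zipWith; []=⇒lookup; lookup⇒[]=)
open import Data.Product using (_,_; proj₁; proj₂; ∃-syntax)
open import Data.Empty using (⊥)
open import Function using (_∘_)
open import Relation.Binary.PropositionalEquality using (refl; sym; trans; cong; subst; subst₂; module ≡-Reasoning)
open import Relation.Nullary using (¬_; yes; no; ¬?; contradiction)
open import Relation.Nullary.Decidable using (_×-dec_; decidable-stable)
open import Algebra.Properties.CommutativeSemigroup +-commutativeSemigroup
  using () renaming (x∙yz≈y∙xz to +-left-comm)
open import Algebra.Properties.CommutativeSemigroup *-commutativeSemigroup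
  using () renaming (x∙yz≈y∙xz to *-left-comm)
open import Algebra.Properties.Semiring.Sum +-*-semiring
  using (sum-syntax; ∑-comm; *-distribˡ-sum; sum-cong-≗)

𝟙 : Bool → ℕ
𝟙 true  = 1
𝟙 false = 0

χ : ∀ {n} → Subset n → Fin n → ℕ
χ p i = 𝟙 (lookup p i)

∑∈ : ∀ {n} → Subset n → (Fin n → ℕ) → ℕ
∑∈ {n} p f = ∑[ i < n ] (χ p i * f i)

syntax ∑∈ p (λ i → e) = ∑[ i ∈ p ] e

∣p∣≡∑χ : ∀ {n} (p : Subset n) → ∣ p ∣ ≡ ∑[ i < n ] χ p i
∣p∣≡∑χ []          = refl
∣p∣≡∑χ (true  ∷ p) = cong suc (∣p∣≡∑χ p)
∣p∣≡∑χ (false ∷ p) = ∣p∣≡∑χ p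

χ-∉ : ∀ {n} {p : Subset n} {i} → i ∉ p → χ p i ≡ 0
χ-∉ {p = p} {i} i∉p with lookup p i in eq
... | true  = contradiction (lookup⇒[]= i p eq) i∉p
... | false = refl

χ-∩ : ∀ {n} (p q : Subset n) i → χ (p ∩ q) i ≡ χ p i * χ q i
χ-∩ p q i rewrite lookup-zipWith _∧_ i p q with lookup p i | lookup q i
... | true  | b = sym (+-identityʳ (𝟙 b))
... | false | b = refl

∣∩∣≡∑∈ : ∀ {n} (p q : Subset n) → ∣ p ∩ q ∣ ≡ ∑[ i ∈ p ] χ q i
∣∩∣≡∑∈ p q = trans (∣p∣≡∑χ (p ∩ q)) (sum-cong-≗ (χ-∩ p q))

∑∈-cong : ∀ {n} (p : Subset n) {f g : Fin n → ℕ} → (∀ i → i ∈ p → f i ≡ g i) →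
  ∑[ i ∈ p ] f i ≡ ∑[ i ∈ p ] g i
∑∈-cong p {f} {g} f≗g = sum-cong-≗ pointwise
  where
  pointwise : ∀ i → χ p i * f i ≡ χ p i * g i
  pointwise i with i ∈? p
  ... | yes i∈p = cong (χ p i *_) (f≗g i i∈p)
  ... | no  i∉p rewrite χ-∉ i∉p = refl

∑∈-one : ∀ {n} (p : Subset n) → ∑[ i ∈ p ] 1 ≡ ∣ p ∣
∑∈-one p = trans (sum-cong-≗ (λ i → *-identityʳ (χ p i))) (sym (∣p∣≡∑χ p))

∑∈-lower : ∀ {n} (p : Subset n) (f : Fin n → ℕ) k → (∀ i → i ∈ p → k ≤ f i) →
  k * ∣ p ∣ ≤ ∑[ i ∈ p ] f i
∑∈-lower []          f k lb = ≤-reflexive (*-zeroʳ k)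
∑∈-lower (true  ∷ p) f k lb = begin
  k * suc ∣ p ∣                  ≡⟨ *-suc k ∣ p ∣ ⟩
  k + k * ∣ p ∣                  ≤⟨ +-mono-≤ (lb zero here) (∑∈-lower p (f ∘ suc) k (λ i → lb (suc i) ∘ there)) ⟩
  f zero + ∑[ i ∈ p ] f (suc i)  ≡⟨ cong (_+ ∑[ i ∈ p ] f (suc i)) (+-identityʳ (f zero)) ⟨
  ∑[ i ∈ true ∷ p ] f i          ∎
  where open ≤-Reasoning
∑∈-lower (false ∷ p) f k lb = ∑∈-lower p (f ∘ suc) k (λ i → lb (suc i) ∘ there)

∑∈-remove : ∀ {n} {p : Subset n} {x} (f : Fin n → ℕ) → x ∈ p →
  ∑[ i ∈ p ] f i ≡ f x + ∑[ i ∈ p - x ] f i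
∑∈-remove {p = true ∷ p} f here = begin
  ∑[ i ∈ true ∷ p ] f i
    ≡⟨ cong (_+ ∑[ i ∈ p ] f (suc i)) (+-identityʳ (f zero)) ⟩
  f zero + ∑[ i ∈ p ] f (suc i)
    ≡⟨ cong (λ r → f zero + ∑[ i ∈ r ] f (suc i)) (p─⊥≡p p) ⟨
  f zero + ∑[ i ∈ (true ∷ p) - zero ] f i ∎
  where open ≡-Reasoning
∑∈-remove {p = b ∷ p} {suc x} f (there x∈p) = begin
  χ (b ∷ p) zero * f zero + ∑[ i ∈ p ] f (suc i)
    ≡⟨ cong (χ (b ∷ p) zero * f zero +_) (∑∈-remove (f ∘ suc) x∈p) ⟩
  χ (b ∷ p) zero * f zero + (f (suc x) + ∑[ i ∈ p - x ] f (suc i))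
    ≡⟨ +-left-comm (χ (b ∷ p) zero * f zero) (f (suc x)) _ ⟩
  f (suc x) + ∑[ i ∈ (b ∷ p) - suc x ] f i ∎
  where open ≡-Reasoning

∣p-x∣ : ∀ {n} {p : Subset n} {x} → x ∈ p → suc ∣ p - x ∣ ≡ ∣ p ∣
∣p-x∣ {p = p} {x} x∈p = begin
  suc ∣ p - x ∣         ≡⟨ cong suc (∑∈-one (p - x)) ⟨
  1 + ∑[ i ∈ p - x ] 1  ≡⟨ ∑∈-remove (λ _ → 1) x∈p ⟨
  ∑[ i ∈ p ] 1          ≡⟨ ∑∈-one p ⟩
  ∣ p ∣                 ∎
  where open ≡-Reasoning

∑∈-lower-two : ∀ {n} {p : Subset n} {a b} (f : Fin n → ℕ) k r →
  a ∈ p → b ∈ p - a → (∀ i → k ≤ f i) → ∣ p ∣ ≡ 2 + r →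
  f a + f b + k * r ≤ ∑[ i ∈ p ] f i
∑∈-lower-two {p = p} {a} {b} f k r a∈p b∈p-a lb ∣p∣≡2+r = begin
  f a + f b + k * r                     ≡⟨ +-assoc (f a) (f b) (k * r) ⟩
  f a + (f b + k * r)                   ≡⟨ cong (λ s → f a + (f b + k * s)) ∣p-a-b∣≡r ⟨
  f a + (f b + k * ∣ p - a - b ∣)       ≤⟨ +-monoʳ-≤ (f a) (+-monoʳ-≤ (f b)
                                             (∑∈-lower (p - a - b) f k (λ i _ → lb i))) ⟩
  f a + (f b + ∑[ i ∈ p - a - b ] f i)  ≡⟨ cong (f a +_) (∑∈-remove f b∈p-a) ⟨
  f a + ∑[ i ∈ p - a ] f i              ≡⟨ ∑∈-remove f a∈p ⟨
  ∑[ i ∈ p ] f i                        ∎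
  where
  open ≤-Reasoning
  ∣p-a-b∣≡r : ∣ p - a - b ∣ ≡ r
  ∣p-a-b∣≡r = suc-injective (suc-injective
    (trans (cong suc (∣p-x∣ b∈p-a)) (trans (∣p-x∣ a∈p) ∣p∣≡2+r)))

_ᵀ : ∀ {m n} → (Fin m → Subset n) → Fin n → Subset m
(R ᵀ) z = tabulate (λ i → lookup (R i) z)

χ-ᵀ : ∀ {m n} (R : Fin m → Subset n) z i → χ ((R ᵀ) z) i ≡ χ (R i) z
χ-ᵀ R z i = cong 𝟙 (lookup∘tabulate (λ j → lookup (R j) z) i)

∈ᵀ⁺ : ∀ {m n} (R : Fin m → Subset n) {z i} → z ∈ R i → i ∈ (R ᵀ) z
∈ᵀ⁺ R {z} {i} z∈Ri =
  lookup⇒[]= i ((R ᵀ) z) (trans (lookup∘tabulate (λ j → lookup (R j) z) i) ([]=⇒lookup z∈Ri))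

∈ᵀ⁻ : ∀ {m n} (R : Fin m → Subset n) {z i} → i ∈ (R ᵀ) z → z ∈ R i
∈ᵀ⁻ R {z} {i} i∈Rᵀz =
  lookup⇒[]= z (R i) (trans (sym (lookup∘tabulate (λ j → lookup (R j) z) i)) ([]=⇒lookup i∈Rᵀz))

double-count : ∀ {m n} (T : Subset m) (S : Subset n) (R : Fin m → Subset n) →
  ∑[ i ∈ T ] ∣ S ∩ R i ∣ ≡ ∑[ z ∈ S ] ∣ T ∩ (R ᵀ) z ∣
double-count {m} {n} T S R = begin
  ∑[ i ∈ T ] ∣ S ∩ R i ∣
    ≡⟨ sum-cong-≗ (λ i → cong (χ T i *_) (∣∩∣≡∑∈ S (R i))) ⟩
  ∑[ i < m ] (χ T i * ∑[ z < n ] (χ S z * χ (R i) z))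
    ≡⟨ sum-cong-≗ (λ i → *-distribˡ-sum (χ T i) (λ z → χ S z * χ (R i) z)) ⟩
  ∑[ i < m ] ∑[ z < n ] (χ T i * (χ S z * χ (R i) z))
    ≡⟨ ∑-comm (λ i z → χ T i * (χ S z * χ (R i) z)) ⟩
  ∑[ z < n ] ∑[ i < m ] (χ T i * (χ S z * χ (R i) z))
    ≡⟨ sum-cong-≗ (λ z → sum-cong-≗ (regroup z)) ⟩
  ∑[ z < n ] ∑[ i < m ] (χ S z * (χ T i * χ ((R ᵀ) z) i))
    ≡⟨ sum-cong-≗ (λ z → *-distribˡ-sum (χ S z) (λ i → χ T i * χ ((R ᵀ) z) i)) ⟨
  ∑[ z < n ] (χ S z * ∑[ i < m ] (χ T i * χ ((R ᵀ) z) i))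
    ≡⟨ sum-cong-≗ (λ z → cong (χ S z *_) (∣∩∣≡∑∈ T ((R ᵀ) z))) ⟨
  ∑[ z ∈ S ] ∣ T ∩ (R ᵀ) z ∣ ∎
  where
  open ≡-Reasoning
  regroup : ∀ z i → χ T i * (χ S z * χ (R i) z) ≡ χ S z * (χ T i * χ ((R ᵀ) z) i)
  regroup z i = trans (*-left-comm (χ T i) (χ S z) (χ (R i) z))
                      (cong (λ c → χ S z * (χ T i * c)) (sym (χ-ᵀ R z i)))

∣p∣≡1 : ∀ {n} {p : Subset n} x → x ∈ p → (∀ y → y ∈ p → y ≡ x) → ∣ p ∣ ≡ 1
∣p∣≡1 {p = p} x x∈p unique = trans (cong ∣_∣ p≡⁅x⁆) (∣⁅x⁆∣≡1 x)
  where
  p≡⁅x⁆ : p ≡ ⁅ x ⁆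
  p≡⁅x⁆ = ⊆-antisym (λ {y} y∈p → subst (_∈ ⁅ x ⁆) (sym (unique y y∈p)) (x∈⁅x⁆ x))
                    (λ {y} y∈⁅x⁆ → subst (_∈ p) (sym (x∈⁅y⁆⇒x≡y x y∈⁅x⁆)) x∈p)

missing-point : ∀ {n} (p q : Subset n) → ∣ p ∩ q ∣ < ∣ q ∣ → ∃[ x ] (x ∈ q × x ∉ p)
missing-point p q ∣p∩q∣<∣q∣ with any? (λ x → (x ∈? q) ×-dec (¬? (x ∈? p)))
... | yes found = found
... | no  none  = contradiction (p⊆q⇒∣p∣≤∣q∣ q⊆p∩q) (<⇒≱ ∣p∩q∣<∣q∣)
  where
  q⊆p∩q : q ⊆ p ∩ q
  q⊆p∩q {x} x∈q = x∈p∩q⁺ (decidable-stable (x ∈? p) (λ x∉p → none (x , x∈q , x∉p)) , x∈q)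

∩-monoˡ-⊆ : ∀ {n} {p p′ : Subset n} (q : Subset n) → p ⊆ p′ → p ∩ q ⊆ p′ ∩ q
∩-monoˡ-⊆ {p = p} q p⊆p′ x∈p∩q with x∈p∩q⁻ p q x∈p∩q
... | x∈p , x∈q = x∈p∩q⁺ (p⊆p′ x∈p , x∈q)

─-∩ : ∀ {n} (p q r : Subset n) → (p ─ r) ∩ q ≡ (p ∩ q) ─ r
─-∩ []      []      []          = refl
─-∩ (x ∷ p) (y ∷ q) (true  ∷ r) = cong (false ∷_) (─-∩ p q r)
─-∩ (x ∷ p) (y ∷ q) (false ∷ r) = cong (x ∧ y ∷_) (─-∩ p q r)

x∉p-x : ∀ {n} {p : Subset n} x → x ∉ p - x
x∉p-x {p = _ ∷ _} zero    ()
x∉p-x {p = _ ∷ p} (suc x) (there x∈p-x) = x∉p-x {p = p} x x∈p-x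

module Plane (Π : ProjectivePlane) where

  linesThrough : Fin (nP Π) → Subset (nL Π)
  linesThrough = pts Π ᵀ

  through⁺ : ∀ {c m} → c ∈ pts Π m → m ∈ linesThrough c
  through⁺ = ∈ᵀ⁺ (pts Π)

  through⁻ : ∀ {c m} → m ∈ linesThrough c → c ∈ pts Π m
  through⁻ = ∈ᵀ⁻ (pts Π)

  ∣common-lines∣ : ∀ {x y} → x ≢ y → ∣ linesThrough x ∩ linesThrough y ∣ ≡ 1
  ∣common-lines∣ {x} {y} x≢y with joinLine Π x y x≢y
  ... | ℓ , (x∈ℓ , y∈ℓ) , unique =
    ∣p∣≡1 ℓ (x∈p∩q⁺ (through⁺ x∈ℓ , through⁺ y∈ℓ)) λ m m∈Lx∩Ly →
      let m∈Lx , m∈Ly = x∈p∩q⁻ (linesThrough x) (linesThrough y) m∈Lx∩Ly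
      in unique m (through⁻ m∈Lx) (through⁻ m∈Ly)

  ∣common-points∣ : ∀ {ℓ m} → ℓ ≢ m → ∣ pts Π ℓ ∩ pts Π m ∣ ≡ 1
  ∣common-points∣ {ℓ} {m} ℓ≢m with meetPoint Π ℓ m ℓ≢m
  ... | x , (x∈ℓ , x∈m) , unique =
    ∣p∣≡1 x (x∈p∩q⁺ (x∈ℓ , x∈m)) λ y y∈ℓ∩m →
      let y∈ℓ , y∈m = x∈p∩q⁻ (pts Π ℓ) (pts Π m) y∈ℓ∩m
      in unique y y∈ℓ y∈m

  -- The lines through c partition the points other than c, so they count any
  -- point set S avoiding c.
  pencil : ∀ {c} (S : Subset (nP Π)) → c ∉ S →
    ∣ S ∣ ≡ ∑[ m ∈ linesThrough c ] ∣ S ∩ pts Π m ∣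
  pencil {c} S c∉S = begin
    ∣ S ∣                                           ≡⟨ ∑∈-one S ⟨
    ∑[ z ∈ S ] 1                                    ≡⟨ ∑∈-cong S (λ z z∈S → sym (∣common-lines∣ (c≢ z∈S))) ⟩
    ∑[ z ∈ S ] ∣ linesThrough c ∩ linesThrough z ∣  ≡⟨ double-count (linesThrough c) S (pts Π) ⟨
    ∑[ m ∈ linesThrough c ] ∣ S ∩ pts Π m ∣         ∎
    where
    open ≡-Reasoning
    c≢ : ∀ {z} → z ∈ S → c ≢ z
    c≢ z∈S refl = c∉S z∈S

  -- A point off a line ℓ lies on exactly |ℓ| lines: the pencil counts ℓ once
  -- per line.
  degree : ∀ {c ℓ} → c ∉ pts Π ℓ → ∣ linesThrough c ∣ ≡ ∣ pts Π ℓ ∣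
  degree {c} {ℓ} c∉ℓ = begin
    ∣ linesThrough c ∣                             ≡⟨ ∑∈-one (linesThrough c) ⟨
    ∑[ m ∈ linesThrough c ] 1                      ≡⟨ ∑∈-cong (linesThrough c)
                                                        (λ m m∈Lc → sym (∣common-points∣ (ℓ≢ m∈Lc))) ⟩
    ∑[ m ∈ linesThrough c ] ∣ pts Π ℓ ∩ pts Π m ∣  ≡⟨ pencil (pts Π ℓ) c∉ℓ ⟨
    ∣ pts Π ℓ ∣                                    ∎
    where
    open ≡-Reasoning
    ℓ≢ : ∀ {m} → m ∈ linesThrough c → ℓ ≢ m
    ℓ≢ m∈Lc refl = c∉ℓ (through⁻ m∈Lc)

-- The arithmetic behind the two counts, with q = k + 1.
3q∸1 : ∀ k → 3 * suc k ∸ 1 ≡ 2 + 3 * k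
3q∸1 k = unfolded k
  where
  unfolded : ∀ k → k + (suc k + (suc k + 0)) ≡ 2 + 3 * k
  unfolded = solve-∀

-- Lines through a point off ℓb: k + 3 + 2k exceeds 3q − 1.
excess-off-line : ∀ k t → 3 ≤ t → k + t + 2 * k ≤ 3 * suc k ∸ 1 → ⊥
excess-off-line k t 3≤t bound = <⇒≱ 3≤t (+-cancelʳ-≤ (3 * k) t 2 bound′)
  where
  regroup : ∀ k t → k + t + 2 * k ≡ t + 3 * k
  regroup = solve-∀
  bound′ : t + 3 * k ≤ 2 + 3 * k
  bound′ = subst₂ _≤_ (regroup k t) (3q∸1 k) bound

-- Lines through the corner: (k − 1) + (k − 1) + 2k ≤ 3q − 2 forces k ≤ 3.
excess-at-corner : ∀ k a b s → 4 ≤ k → suc a ≡ k → suc b ≡ k → suc s ≡ 3 * suc k ∸ 1 →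
  a + b + 2 * k ≤ s → ⊥
excess-at-corner .(suc a) a .a s (s≤s 3≤a) refl refl ∣S∣ bound =
  <⇒≱ 3≤a (+-cancelʳ-≤ (2 + 3 * a) a 2 bound′)
  where
  regroup : ∀ a → a + a + 2 * suc a ≡ a + (2 + 3 * a)
  regroup = solve-∀
  shift : ∀ a → 2 + 3 * suc a ≡ suc (2 + (2 + 3 * a))
  shift = solve-∀
  s≡ : s ≡ 2 + (2 + 3 * a)
  s≡ = suc-injective (trans ∣S∣ (trans (3q∸1 (suc a)) (shift a)))
  bound′ : a + (2 + 3 * a) ≤ 2 + (2 + 3 * a)
  bound′ = subst₂ _≤_ (regroup a) s≡ bound

-- The configuration of the theorem, with q = k + 1: B has size 3q − 1, and the
-- k-secants ℓa, ℓb meet in a point (the corner) of B.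
module Configuration
  (Π : ProjectivePlane) {k : ℕ} (order : HasOrder Π (suc k))
  {B : Subset (nP Π)} (blocking : IsDoubleBlocking Π B) (∣B∣ : ∣ B ∣ ≡ 3 * suc k ∸ 1)
  {ℓa ℓb : Fin (nL Π)} (ℓa≢ℓb : ℓa ≢ ℓb)
  (secantA : IsSecant Π k B ℓa) (secantB : IsSecant Π k B ℓb)
  (corner∈B : ∀ x → x ∈ pts Π ℓa → x ∈ pts Π ℓb → x ∈ B) where

  open Plane Π

  corner : Fin (nP Π)
  corner = proj₁ (meetPoint Π ℓa ℓb ℓa≢ℓb)

  corner∈ℓa : corner ∈ pts Π ℓa
  corner∈ℓa = proj₁ (proj₁ (proj₂ (meetPoint Π ℓa ℓb ℓa≢ℓb)))

  corner∈ℓb : corner ∈ pts Π ℓb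
  corner∈ℓb = proj₂ (proj₁ (proj₂ (meetPoint Π ℓa ℓb ℓa≢ℓb)))

  corner-unique : ∀ {x} → x ∈ pts Π ℓa → x ∈ pts Π ℓb → x ≡ corner
  corner-unique {x} = proj₂ (proj₂ (meetPoint Π ℓa ℓb ℓa≢ℓb)) x

  -- A k-secant has q + 1 > k points, hence a point outside B.
  gap : ∀ ℓ → IsSecant Π k B ℓ → ∃[ u ] (u ∈ pts Π ℓ × u ∉ B)
  gap ℓ secant = missing-point B (pts Π ℓ)
    (subst₂ _<_ (sym secant) (sym (order ℓ)) (s≤s (m≤m+n k 1)))

  -- ℓa ∩ ℓb lies in B, so points of one secant outside B are off the other.
  off-ℓa : ∀ {u} → u ∈ pts Π ℓb → u ∉ B → u ∉ pts Π ℓa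
  off-ℓa u∈ℓb u∉B u∈ℓa = u∉B (corner∈B _ u∈ℓa u∈ℓb)

  off-ℓb : ∀ {v} → v ∈ pts Π ℓa → v ∉ B → v ∉ pts Π ℓb
  off-ℓb v∈ℓa v∉B v∈ℓb = v∉B (corner∈B _ v∈ℓa v∈ℓb)

  ∣linesThrough∣ : ∀ {c ℓ} → c ∉ pts Π ℓ → ∣ linesThrough c ∣ ≡ 2 + k
  ∣linesThrough∣ {ℓ = ℓ} c∉ℓ = trans (degree c∉ℓ) (trans (order ℓ) (+-comm (suc k) 1))

  -- The line n joining gap points u ∈ ℓb and v ∈ ℓa misses the corner: otherwise
  -- n = corner u = ℓb would contain v.
  corner∉gap-line : ∀ {u v n} → u ∈ pts Π ℓb → u ∉ B → v ∈ pts Π ℓa → v ∉ B →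
    u ∈ pts Π n → v ∈ pts Π n → corner ∉ pts Π n
  corner∉gap-line {u} {v} {n} u∈ℓb u∉B v∈ℓa v∉B u∈n v∈n corner∈n =
    off-ℓb v∈ℓa v∉B (subst (λ l → v ∈ pts Π l) n≡ℓb v∈n)
    where
    n≡ℓb : n ≡ ℓb
    n≡ℓb with joinLine Π corner u (λ { refl → u∉B (corner∈B _ corner∈ℓa corner∈ℓb) })
    ... | _ , _ , unique = trans (unique n corner∈n u∈n) (sym (unique ℓb corner∈ℓb u∈ℓb))

  ∣B-corner∩ℓ∣ : ∀ {ℓ} → corner ∈ pts Π ℓ → IsSecant Π k B ℓ →
    suc ∣ (B - corner) ∩ pts Π ℓ ∣ ≡ k
  ∣B-corner∩ℓ∣ {ℓ} corner∈ℓ secant = begin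
    suc ∣ (B - corner) ∩ pts Π ℓ ∣  ≡⟨ cong (suc ∘ ∣_∣) (─-∩ B (pts Π ℓ) ⁅ corner ⁆) ⟩
    suc ∣ (B ∩ pts Π ℓ) - corner ∣  ≡⟨ ∣p-x∣ (x∈p∩q⁺ (corner∈B _ corner∈ℓa corner∈ℓb , corner∈ℓ)) ⟩
    ∣ B ∩ pts Π ℓ ∣                 ≡⟨ secant ⟩
    k                               ∎
    where open ≡-Reasoning

  -- A double blocking subset C of B must contain every point of B.
  module _ {C : Subset (nP Π)} (C⊆B : C ⊆ B) (blockingC : IsDoubleBlocking Π C) where

    -- Points of B off ℓb: count B along the pencil through a gap point u of ℓb.
    essential-off-ℓb : ∀ {x} → x ∈ B → x ∉ C → x ∉ pts Π ℓb → ⊥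
    essential-off-ℓb {x} x∈B x∉C x∉ℓb with gap ℓb secantB
    ... | u , u∈ℓb , u∉B with joinLine Π u x u≢x
      where
      u≢x : u ≢ x
      u≢x refl = u∉B x∈B
    ... | m , (u∈m , x∈m) , _ = excess-off-line k ∣ B ∩ pts Π m ∣ 3≤∣B∩m∣ count
      where
      m≢ℓb : m ≢ ℓb
      m≢ℓb refl = x∉ℓb x∈m
      -- m carries two points of C and also x ∉ C.
      3≤∣B∩m∣ : 3 ≤ ∣ B ∩ pts Π m ∣
      3≤∣B∩m∣ = ≤-trans (s≤s (blockingC m)) (p⊂q⇒∣p∣<∣q∣
        ( ∩-monoˡ-⊆ (pts Π m) C⊆B
        , x , x∈p∩q⁺ (x∈B , x∈m) , x∉C ∘ proj₁ ∘ x∈p∩q⁻ C (pts Π m) ))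
      count : k + ∣ B ∩ pts Π m ∣ + 2 * k ≤ 3 * suc k ∸ 1
      count = begin
        k + ∣ B ∩ pts Π m ∣ + 2 * k
          ≡⟨ cong (λ a → a + ∣ B ∩ pts Π m ∣ + 2 * k) secantB ⟨
        ∣ B ∩ pts Π ℓb ∣ + ∣ B ∩ pts Π m ∣ + 2 * k
          ≤⟨ ∑∈-lower-two (λ l → ∣ B ∩ pts Π l ∣) 2 k
               (through⁺ u∈ℓb) (x∈p∧x≢y⇒x∈p-y (through⁺ u∈m) m≢ℓb)
               blocking (∣linesThrough∣ (off-ℓa u∈ℓb u∉B)) ⟩
        ∑[ l ∈ linesThrough u ] ∣ B ∩ pts Π l ∣
          ≡⟨ pencil B u∉B ⟨
        ∣ B ∣
          ≡⟨ ∣B∣ ⟩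
        3 * suc k ∸ 1 ∎
        where open ≤-Reasoning

    -- The corner: count B − corner along the pencil through the corner, which
    -- has q + 1 lines because the line joining two gap points misses it.
    essential-corner : 4 ≤ k → corner ∉ C → ⊥
    essential-corner 4≤k corner∉C with gap ℓb secantB | gap ℓa secantA
    ... | u , u∈ℓb , u∉B | v , v∈ℓa , v∉B with joinLine Π u v u≢v
      where
      u≢v : u ≢ v
      u≢v refl = off-ℓa u∈ℓb u∉B v∈ℓa
    ... | n , (u∈n , v∈n) , _ =
      excess-at-corner k (∣ S ∩ pts Π ℓa ∣) (∣ S ∩ pts Π ℓb ∣) ∣ S ∣ 4≤k
        (∣B-corner∩ℓ∣ corner∈ℓa secantA) (∣B-corner∩ℓ∣ corner∈ℓb secantB)
        (trans (∣p-x∣ (corner∈B _ corner∈ℓa corner∈ℓb)) ∣B∣) count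
      where
      S : Subset (nP Π)
      S = B - corner
      C⊆S : C ⊆ S
      C⊆S {y} y∈C = x∈p∧x≢y⇒x∈p-y (C⊆B y∈C) λ { refl → corner∉C y∈C }
      count : ∣ S ∩ pts Π ℓa ∣ + ∣ S ∩ pts Π ℓb ∣ + 2 * k ≤ ∣ S ∣
      count = begin
        ∣ S ∩ pts Π ℓa ∣ + ∣ S ∩ pts Π ℓb ∣ + 2 * k
          ≤⟨ ∑∈-lower-two (λ l → ∣ S ∩ pts Π l ∣) 2 k
               (through⁺ corner∈ℓa) (x∈p∧x≢y⇒x∈p-y (through⁺ corner∈ℓb) (ℓa≢ℓb ∘ sym))
               (λ l → ≤-trans (blockingC l) (p⊆q⇒∣p∣≤∣q∣ (∩-monoˡ-⊆ (pts Π l) C⊆S)))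
               (∣linesThrough∣ (corner∉gap-line u∈ℓb u∉B v∈ℓa v∉B u∈n v∈n)) ⟩
        ∑[ l ∈ linesThrough corner ] ∣ S ∩ pts Π l ∣
          ≡⟨ pencil S (x∉p-x corner) ⟨
        ∣ S ∣ ∎
        where open ≤-Reasoning

proposition10 : (Π : ProjectivePlane) (q : ℕ) → q > 4 → HasOrder Π q →
    (B : Subset (nP Π)) → IsDoubleBlocking Π B → ∣ B ∣ ≡ 3 * q ∸ 1 →
    (ℓ₁ ℓ₂ : Fin (nL Π)) → ℓ₁ ≢ ℓ₂ →
    IsSecant Π (q ∸ 1) B ℓ₁ → IsSecant Π (q ∸ 1) B ℓ₂ →
    (∀ x → x ∈ pts Π ℓ₁ → x ∈ pts Π ℓ₂ → x ∈ B) →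
    IsMinimalDoubleBlocking Π B
proposition10 Π (suc k) (s≤s 4≤k) order B blocking ∣B∣ ℓ₁ ℓ₂ ℓ₁≢ℓ₂ secant₁ secant₂ corner∈B =
  blocking , minimal
  where
  module At₁₂ = Configuration Π order blocking ∣B∣ ℓ₁≢ℓ₂ secant₁ secant₂ corner∈B
  module At₂₁ = Configuration Π order blocking ∣B∣ (ℓ₁≢ℓ₂ ∘ sym) secant₂ secant₁ (λ x x∈ℓ₂ x∈ℓ₁ → corner∈B x x∈ℓ₁ x∈ℓ₂)
  minimal : ∀ C → C ⊂ B → ¬ IsDoubleBlocking Π C
  minimal C (C⊆B , x , x∈B , x∉C) blockingC with x ∈? pts Π ℓ₁ | x ∈? pts Π ℓ₂
  ... | _        | no x∉ℓ₂  = At₁₂.essential-off-ℓb C⊆B blockingC x∈B x∉C x∉ℓ₂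
  ... | no x∉ℓ₁  | yes _    = At₂₁.essential-off-ℓb C⊆B blockingC x∈B x∉C x∉ℓ₁
  ... | yes x∈ℓ₁ | yes x∈ℓ₂ = At₁₂.essential-corner C⊆B blockingC 4≤k
                                 (subst (_∉ C) (At₁₂.corner-unique x∈ℓ₁ x∈ℓ₂) x∉C)
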